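{- Let $\alpha=(a_1,\ldots,a_n)\in[n]^n$ and let $\alpha'=(a'_1,\ldots,a'_n)$ be its weakly increasing rearrangement. Then $\alpha$ is a unit Fubini ranking if and only if $c_i\le a'_i\le i$ for every $i\in[n]$, where $$c_i=\begin{cases}1,&\text{if } i=1,\\ i,&\text{if } 2\le i\le n \text{ and } a'_{i-1}=i-2,\\ i-1,&\text{otherwise}.\end{cases}$$
   Context: $[n]=\{1,\ldots,n\}$. Parking process: $\alpha\in[n]^n$ encodes preferences of cars $1,\ldots,n$ arriving in order at a one-way street with spots $1,\ldots,n$; car $i$ parks in spot $a_i$ if free, otherwise in the first free spot after $a_i$, if any. $\alpha$ is a parking function if all cars park. A unit interval parking function is a parking function in which each car $i$ parks in spot $a_i$ or $a_i+1$. A Fubini ranking is a tuple $(r_1,\ldots,r_n)\in[n]^n$ with $r_i=1+|\{j:r_j<r_i\}|$ for all $i$. A unit Fubini ranking is a tuple that is both a Fubini ranking and a unit interval parking function. -}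

module Defs where

open import Data.Nat using (ℕ; zero; suc; _+_; _∸_; _≤_; _<_; _<?_; _≟_)
open import Data.Nat.Properties using (≤-decTotalOrder)
open import Data.Bool using (if_then_else_)
open import Data.List using (List; []; _∷_; length; filter; zip)
open import Data.List.Membership.DecPropositional _≟_ using (_∈?_)
open import Data.List.Relation.Unary.All using (All)
open import Data.Maybe using (Maybe; just; nothing)
open import Data.Vec using (Vec; toList)
open import Data.Product using (_×_; _,_; ∃)
open import Data.Sum using (_⊎_)
open import Relation.Binary.PropositionalEquality using (_≡_)
open import Relation.Nullary using (does)
open import Data.List.Sort ≤-decTotalOrder using (sort)

firstFree : List ℕ → ℕ → ℕ → Maybe ℕ
firstFree occ a zero    = nothing
firstFree occ a (suc k) = if does (a ∈? occ) then firstFree occ (suc a) k else just a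

-- Spot taken by a car with preference a, given occupied spots occ, on the
-- street with spots 1..n: the first free spot s with a ≤ s ≤ n (if any).
parkCar : ℕ → List ℕ → ℕ → Maybe ℕ
parkCar n occ a = firstFree occ a (suc n ∸ a)

parkingRun : ℕ → List ℕ → List ℕ → List (Maybe ℕ)
parkingRun n occ []       = []
parkingRun n occ (a ∷ as) with parkCar n occ a
... | just s  = just s  ∷ parkingRun n (s ∷ occ) as
... | nothing = nothing ∷ parkingRun n occ as

outcome : ∀ {n} → Vec ℕ n → List (Maybe ℕ)
outcome {n} α = parkingRun n [] (toList α)

IsParkingFunction : ∀ {n} → Vec ℕ n → Set
IsParkingFunction α = All (λ o → ∃ λ s → o ≡ just s) (outcome α)

ParksAtOrNext : ℕ × Maybe ℕ → Set
ParksAtOrNext (a , o) = (o ≡ just a) ⊎ (o ≡ just (suc a))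

IsUnitIntervalPF : ∀ {n} → Vec ℕ n → Set
IsUnitIntervalPF α = IsParkingFunction α × All ParksAtOrNext (zip (toList α) (outcome α))

IsFubiniRanking : ∀ {n} → Vec ℕ n → Set
IsFubiniRanking α = All (λ r → r ≡ suc (length (filter (_<? r) (toList α)))) (toList α)

IsUnitFubini : ∀ {n} → Vec ℕ n → Set
IsUnitFubini α = IsFubiniRanking α × IsUnitIntervalPF α

rearr : ∀ {n} → Vec ℕ n → List ℕ
rearr α = sort (toList α)

-- nth xs i = i-th entry (1-indexed); 0 outside the range (never used
-- in the statement for i ∈ [n], since the rearrangement has length n).
nth : List ℕ → ℕ → ℕ
nth []       _             = 0
nth (x ∷ xs) zero          = 0
nth (x ∷ xs) (suc zero)    = x
nth (x ∷ xs) (suc (suc i)) = nth xs (suc i)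

cc : List ℕ → ℕ → ℕ
cc a' zero          = 1      -- unused (i ≥ 1)
cc a' (suc zero)    = 1
cc a' (suc (suc j)) = if does (nth a' (suc j) ≟ j) then suc (suc j) else suc j

{-# OPTIONS --safe #-}
-- Three cars preferring v would need three distinct spots among v and v + 1, so in a unit interval
-- parking function no preference occurs more than twice. Conversely, in a Fubini ranking two
-- copies of v push every larger rank to at least v + 2, so v + 1 is nobody's preference; hence if
-- no value occurs more than twice, the first car preferring v parks at v and the second at v + 1.
-- Unit Fubini rankings are therefore the Fubini rankings with all multiplicities at most two, a
-- property of the multiset. Sorted, these are the sequences made of blocks (i) and (i, i), each
-- starting at position i, and the bounds c_i ≤ a'_i ≤ i say exactly this: a'_i ∈ {i - 1, i},
-- with a'_i = i - 1 only right after a'_(i-1) = i - 1.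
module Submission where

open import Defs
open import Data.Nat using (ℕ; zero; suc; _+_; _∸_; _≤_; _<_; _<?_; _≟_; _≤?_; z≤n; s≤s)
open import Data.Nat.Properties
open import Data.Bool using (true; false; if_then_else_)
open import Data.List using (List; []; _∷_; _++_; length; filter; zip)
open import Data.List.Properties
  using (filter-accept; filter-reject; filter-none; filter-some; filter-++; length-++; length-filter)
open import Data.List.Membership.Propositional using (_∈_; _∉_)
open import Data.List.Membership.Propositional.Properties using (∈-++⁺ˡ; ∈-++⁺ʳ)
open import Data.List.Membership.DecPropositional _≟_ using (_∈?_)
open import Data.List.Relation.Binary.Permutation.Propositional using (_↭_; ↭-refl; ↭-sym; ↭-trans)
open import Data.List.Relation.Binary.Permutation.Propositional.Properties
  using (filter-↭; ↭-length; All-resp-↭; ∈-resp-↭; shift)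
open import Data.List.Relation.Unary.All as All using (All; []; _∷_)
open import Data.List.Relation.Unary.All.Properties using (¬Any⇒All¬)
open import Data.List.Relation.Unary.Any as Any using (here; there)
open import Data.List.Relation.Unary.Linked using ([-]; _∷_)
open import Data.List.Relation.Unary.Linked.Properties using (Linked⇒All)
open import Data.List.Relation.Unary.Sorted.TotalOrder ≤-totalOrder using (Sorted)
open import Data.List.Sort ≤-decTotalOrder using (sort-↭; sort-↗)
open import Data.Maybe using (just; nothing)
open import Data.Maybe.Properties using (just-injective)
open import Data.Product using (_×_; _,_; ∃; uncurry)
open import Data.Sum using (_⊎_; inj₁; inj₂)
open import Data.Unit using (⊤; tt)
open import Data.Vec using (Vec; lookup; toList)
open import Data.Vec.Properties using (length-toList)
open import Function.Base using (_∘_; case_of_)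
open import Function.Bundles using (_⇔_; mk⇔; Equivalence)
open import Function.Properties.Equivalence using () renaming (trans to ⇔-trans)
open import Relation.Nullary using (¬_; yes; no; does; contradiction)
open import Relation.Nullary.Decidable using (dec-true; dec-false)
open import Relation.Binary.Definitions using (tri<; tri≈; tri>)
open import Relation.Binary.PropositionalEquality
  using (_≡_; _≢_; refl; sym; trans; cong; cong₂; subst; module ≡-Reasoning)

variable
  k m n p r s v x : ℕ
  xs ys q rp occ : List ℕ

opaque
  countBelow : ℕ → List ℕ → ℕ
  countBelow r xs = length (filter (_<? r) xs)

  multiplicity : ℕ → List ℕ → ℕ
  multiplicity v xs = length (filter (_≟ v) xs)

  countBelow-accept : x < r → countBelow r (x ∷ xs) ≡ suc (countBelow r xs)
  countBelow-accept x<r = cong length (filter-accept (_<? _) x<r)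

  countBelow-filter : countBelow r xs ≡ length (filter (_<? r) xs)
  countBelow-filter = refl

  countBelow≤length : ∀ xs → countBelow r xs ≤ length xs
  countBelow≤length xs = length-filter (_<? _) xs

  countBelow-reject : ¬ x < r → countBelow r (x ∷ xs) ≡ countBelow r xs
  countBelow-reject x≮r = cong length (filter-reject (_<? _) x≮r)

  countBelow-none : All (r ≤_) xs → countBelow r xs ≡ 0
  countBelow-none r≤xs = cong length (filter-none (_<? _) (All.map ≤⇒≯ r≤xs))

  countBelow-↭ : xs ↭ ys → countBelow r xs ≡ countBelow r ys
  countBelow-↭ xs↭ys = ↭-length (filter-↭ (_<? _) xs↭ys)

  multiplicity-↭ : xs ↭ ys → multiplicity v xs ≡ multiplicity v ys
  multiplicity-↭ xs↭ys = ↭-length (filter-↭ (_≟ _) xs↭ys)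

  multiplicity-++ : ∀ xs ys → multiplicity v (xs ++ ys) ≡ multiplicity v xs + multiplicity v ys
  multiplicity-++ xs ys = trans (cong length (filter-++ (_≟ _) xs ys)) (length-++ (filter (_≟ _) xs))

  multiplicity-[] : multiplicity v [] ≡ 0
  multiplicity-[] = refl

  multiplicity-self : multiplicity v (v ∷ xs) ≡ suc (multiplicity v xs)
  multiplicity-self {v} = cong length (filter-accept (_≟ v) refl)

  multiplicity-other : x ≢ v → multiplicity v (x ∷ xs) ≡ multiplicity v xs
  multiplicity-other x≢v = cong length (filter-reject (_≟ _) x≢v)

  multiplicity-cons : multiplicity v xs ≤ multiplicity v (x ∷ xs)
  multiplicity-cons {v} {xs} {x} with x ≟ v
  ... | yes refl = ≤-trans (n≤1+n _) (≤-reflexive (sym (multiplicity-self {xs = xs})))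
  ... | no x≢v = ≤-reflexive (sym (multiplicity-other x≢v))

  multiplicity-above : All (v <_) xs → multiplicity v xs ≡ 0
  multiplicity-above v<xs = cong length (filter-none (_≟ _) (All.map >⇒≢ v<xs))

  ∈⇒multiplicity : v ∈ xs → 0 < multiplicity v xs
  ∈⇒multiplicity v∈xs = filter-some (_≟ _) (Any.map sym v∈xs)

  multiplicity⇒∈ : ∀ xs → 0 < multiplicity v xs → v ∈ xs
  multiplicity⇒∈ {v} (x ∷ xs) positive with x ≟ v
  ... | yes refl = here refl
  ... | no x≢v = there (multiplicity⇒∈ xs (subst (0 <_) (multiplicity-other x≢v) positive))

  countBelow-suc : ∀ xs → countBelow (suc v) xs ≡ countBelow v xs + multiplicity v xs
  countBelow-suc [] = refl
  countBelow-suc {v} (x ∷ xs) with <-cmp x v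
  ... | tri< x<v x≢v _ = begin
    countBelow (suc v) (x ∷ xs)                     ≡⟨ countBelow-accept (m<n⇒m<1+n x<v) ⟩
    suc (countBelow (suc v) xs)                     ≡⟨ cong suc (countBelow-suc xs) ⟩
    suc (countBelow v xs) + multiplicity v xs       ≡⟨ cong₂ _+_ (sym (countBelow-accept x<v)) (sym (multiplicity-other x≢v)) ⟩
    countBelow v (x ∷ xs) + multiplicity v (x ∷ xs) ∎
    where open ≡-Reasoning
  ... | tri≈ _ refl _ = begin
    countBelow (suc v) (v ∷ xs)                     ≡⟨ countBelow-accept (n<1+n v) ⟩
    suc (countBelow (suc v) xs)                     ≡⟨ cong suc (countBelow-suc xs) ⟩
    suc (countBelow v xs + multiplicity v xs)       ≡⟨ sym (+-suc _ _) ⟩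
    countBelow v xs + suc (multiplicity v xs)       ≡⟨ cong₂ _+_ (sym (countBelow-reject {xs = xs} (<-irrefl refl)))
                                                              (sym (multiplicity-self {xs = xs})) ⟩
    countBelow v (v ∷ xs) + multiplicity v (v ∷ xs) ∎
    where open ≡-Reasoning
  ... | tri> _ x≢v v<x = begin
    countBelow (suc v) (x ∷ xs)                     ≡⟨ countBelow-reject (≤⇒≯ v<x) ⟩
    countBelow (suc v) xs                           ≡⟨ countBelow-suc xs ⟩
    countBelow v xs + multiplicity v xs             ≡⟨ cong₂ _+_ (sym (countBelow-reject (<⇒≯ v<x))) (sym (multiplicity-other x≢v)) ⟩
    countBelow v (x ∷ xs) + multiplicity v (x ∷ xs) ∎
    where open ≡-Reasoning

AtMostTwice : List ℕ → Set
AtMostTwice xs = ∀ v → multiplicity v xs ≤ 2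

atMostTwice-↭ : xs ↭ ys → AtMostTwice xs → AtMostTwice ys
atMostTwice-↭ xs↭ys twice v = subst (_≤ 2) (multiplicity-↭ xs↭ys) (twice v)

atMostTwice-cons : multiplicity x xs ≤ 1 → AtMostTwice xs → AtMostTwice (x ∷ xs)
atMostTwice-cons {x} once twice v with x ≟ v
... | yes refl = subst (_≤ 2) (sym multiplicity-self) (s≤s once)
... | no x≢v = subst (_≤ 2) (sym (multiplicity-other x≢v)) (twice v)

atMostTwice-tail : AtMostTwice (x ∷ xs) → AtMostTwice xs
atMostTwice-tail {x} {xs} twice v = ≤-trans (multiplicity-cons {xs = xs} {x}) (twice v)

atMostTwice-absent : AtMostTwice (v ∷ v ∷ xs) → v ∉ xs
atMostTwice-absent {v} {xs} twice v∈xs = 1+n≰n (begin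
  3                                 ≤⟨ s≤s (s≤s (∈⇒multiplicity v∈xs)) ⟩
  suc (suc (multiplicity v xs))     ≡⟨ sym (trans multiplicity-self (cong suc multiplicity-self)) ⟩
  multiplicity v (v ∷ v ∷ xs)       ≤⟨ twice v ⟩
  2                                 ∎)
  where open ≤-Reasoning

-- HasRank k xs r: the entry r equals its Fubini rank in the list obtained from xs by prepending k
-- entries smaller than all of xs.
HasRank : ℕ → List ℕ → ℕ → Set
HasRank k xs r = r ≡ suc (k + countBelow r xs)

FubiniOffset : ℕ → List ℕ → Set
FubiniOffset k xs = All (HasRank k xs) xs

fubiniOffset-↭ : xs ↭ ys → FubiniOffset k xs → FubiniOffset k ys
fubiniOffset-↭ {k = k} xs↭ys ranks =
  All-resp-↭ xs↭ys (All.map (λ e → trans e (cong (λ c → suc (k + c)) (countBelow-↭ xs↭ys))) ranks)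

fubiniRanking⇔fubiniOffset : ∀ {n} (α : Vec ℕ n) → IsFubiniRanking α ⇔ FubiniOffset 0 (toList α)
fubiniRanking⇔fubiniOffset α = mk⇔
  (All.map (λ e → trans e (cong suc (sym countBelow-filter))))
  (All.map (λ e → trans e (cong suc countBelow-filter)))

offset-absorb : x < r → k + countBelow r (x ∷ xs) ≡ suc k + countBelow r xs
offset-absorb {k = k} x<r = trans (cong (k +_) (countBelow-accept x<r)) (+-suc k _)

hasRank-absorb : All (x <_) ys → All (HasRank (suc k) xs) ys → All (HasRank k (x ∷ xs)) ys
hasRank-absorb above ranks = All.zipWith (λ (x<r , e) → trans e (cong suc (sym (offset-absorb x<r)))) (above , ranks)

hasRank-extract : All (x <_) ys → All (HasRank k (x ∷ xs)) ys → All (HasRank (suc k) xs) ys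
hasRank-extract above ranks = All.zipWith (λ (x<r , e) → trans e (cong suc (offset-absorb x<r))) (above , ranks)

offset-minimum : All (r ≤_) xs → k + countBelow r xs ≡ k
offset-minimum {k = k} r≤xs = trans (cong (k +_) (countBelow-none r≤xs)) (+-identityʳ k)

data Blocks : ℕ → List ℕ → Set where
  []     : Blocks k []
  single : Blocks (suc k) xs → Blocks k (suc k ∷ xs)
  double : Blocks (suc (suc k)) xs → Blocks k (suc k ∷ suc k ∷ xs)

blocks-above : Blocks k xs → All (k <_) xs
blocks-above []         = []
blocks-above (single b) = ≤-refl ∷ All.map (<-trans (n<1+n _)) (blocks-above b)
blocks-above (double b) = ≤-refl ∷ ≤-refl ∷ All.map (<-trans (<-trans (n<1+n _) (n<1+n _))) (blocks-above b)

blocks⇒atMostTwice : Blocks k xs → AtMostTwice xs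
blocks⇒atMostTwice []         _ = subst (_≤ 2) (sym multiplicity-[]) z≤n
blocks⇒atMostTwice (single {xs = xs} b) =
  atMostTwice-cons {xs = xs} (subst (_≤ 1) (sym (multiplicity-above (blocks-above b))) z≤n) (blocks⇒atMostTwice b)
blocks⇒atMostTwice {k} (double {xs = xs} b) =
  atMostTwice-cons {xs = suc k ∷ xs} (≤-reflexive (trans multiplicity-self (cong suc absent)))
    (atMostTwice-cons (subst (_≤ 1) (sym absent) z≤n) (blocks⇒atMostTwice b))
  where
  absent : multiplicity (suc k) xs ≡ 0
  absent = multiplicity-above (All.map (<-trans (n<1+n _)) (blocks-above b))

blocks⇒fubiniOffset : Blocks k xs → FubiniOffset k xs
blocks⇒fubiniOffset [] = []
blocks⇒fubiniOffset (single b) =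
  sym (cong suc (offset-minimum (≤-refl ∷ All.map <⇒≤ (blocks-above b))))
  ∷ hasRank-absorb (blocks-above b) (blocks⇒fubiniOffset b)
blocks⇒fubiniOffset {k} (double {xs = xs} b) =
  least ∷ least ∷ hasRank-absorb above (hasRank-absorb above (blocks⇒fubiniOffset b))
  where
  above : All (suc k <_) xs
  above = All.map (<-trans (n<1+n _)) (blocks-above b)
  least : HasRank k (suc k ∷ suc k ∷ xs) (suc k)
  least = sym (cong suc (offset-minimum (≤-refl ∷ ≤-refl ∷ All.map <⇒≤ above)))

sorted-least : Sorted (x ∷ xs) → All (x ≤_) (x ∷ xs)
sorted-least = Linked⇒All ≤-trans ≤-refl

sorted-above : v < x → Sorted (x ∷ xs) → All (v <_) (x ∷ xs)
sorted-above v<x sorted = All.map (<-≤-trans v<x) (sorted-least sorted)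

≤-absent⇒< : All (v ≤_) xs → v ∉ xs → All (v <_) xs
≤-absent⇒< {xs = xs} v≤xs v∉xs = All.zipWith (uncurry ≤∧≢⇒<) (v≤xs , ¬Any⇒All¬ xs v∉xs)

sorted-head : Sorted (x ∷ xs) → HasRank k (x ∷ xs) x → x ≡ suc k
sorted-head sorted rank = trans rank (cong suc (offset-minimum (sorted-least sorted)))

mutual
  sorted⇒blocks : Sorted xs → FubiniOffset k xs → AtMostTwice xs → Blocks k xs
  sorted⇒blocks {[]} _ _ _ = []
  sorted⇒blocks {_ ∷ _} sorted (rank ∷ ranks) twice = sorted⇒blocks-cons (sorted-head sorted rank) sorted ranks twice

  sorted⇒blocks-cons : x ≡ suc k → Sorted (x ∷ xs) → All (HasRank k (x ∷ xs)) xs → AtMostTwice (x ∷ xs) →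
                       Blocks k (x ∷ xs)
  sorted⇒blocks-cons refl [-] _ _ = single []
  sorted⇒blocks-cons {k = k} refl (_∷_ {y = y} k≤y sorted) ranks twice with y ≟ suc k
  ... | yes refl =
    let above = ≤-absent⇒< (All.tail (sorted-least sorted)) (atMostTwice-absent twice)
    in double (sorted⇒blocks-tail sorted (hasRank-extract above (hasRank-extract above (All.tail ranks)))
                                         (atMostTwice-tail (atMostTwice-tail twice)))
  ... | no y≢ =
    let above = sorted-above (≤∧≢⇒< k≤y (y≢ ∘ sym)) sorted
    in single (sorted⇒blocks sorted (hasRank-extract above ranks) (atMostTwice-tail twice))

  sorted⇒blocks-tail : Sorted (x ∷ xs) → FubiniOffset k xs → AtMostTwice xs → Blocks k xs
  sorted⇒blocks-tail [-] _ _ = []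
  sorted⇒blocks-tail (_ ∷ sorted) ranks twice = sorted⇒blocks sorted ranks twice

sorted-fubini×atMostTwice⇔blocks : Sorted xs → (FubiniOffset k xs × AtMostTwice xs) ⇔ Blocks k xs
sorted-fubini×atMostTwice⇔blocks sorted =
  mk⇔ (λ (ranks , twice) → sorted⇒blocks sorted ranks twice)
      (λ blocks → blocks⇒fubiniOffset blocks , blocks⇒atMostTwice blocks)

-- lowerBound m p is the paper's c_(m+1) when a'_m = p, so that cc a' (suc m) = lowerBound m (a'_m).
lowerBound : ℕ → ℕ → ℕ
lowerBound zero    p = 1
lowerBound (suc m) p = if does (p ≟ m) then suc (suc m) else suc m

lowerBound≤ : ∀ m p → lowerBound m p ≤ suc m
lowerBound≤ zero    p = ≤-refl
lowerBound≤ (suc m) p with does (p ≟ m)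
... | true  = ≤-refl
... | false = n≤1+n _

lowerBound-diagonal : ∀ m → lowerBound (suc m) (suc m) ≡ suc m
lowerBound-diagonal m rewrite dec-false (suc m ≟ m) 1+n≢n = refl

lowerBound-lagging : ∀ m → lowerBound (suc m) m ≡ suc (suc m)
lowerBound-lagging m rewrite dec-true (m ≟ m) refl = refl

AdmissibleEntry : ℕ → ℕ → ℕ → Set
AdmissibleEntry m p x = lowerBound m p ≤ x × x ≤ suc m

-- Admissible k p xs: the bounds c_i ≤ a'_i ≤ i for the entries of xs placed at positions
-- k + 1, k + 2, ..., after an entry p at position k.
Admissible : ℕ → ℕ → List ℕ → Set
Admissible k p []       = ⊤
Admissible k p (x ∷ xs) = AdmissibleEntry k p x × Admissible (suc k) x xs

admissibleEntry-forced : lowerBound m p ≡ suc m → AdmissibleEntry m p x → x ≡ suc m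
admissibleEntry-forced forced (lower , upper) = ≤-antisym upper (subst (_≤ _) forced lower)

blocks⇒admissible : Blocks k xs → ∀ p → Admissible k p xs
blocks⇒admissible []         p = tt
blocks⇒admissible {k} (single b) p = (lowerBound≤ k p , ≤-refl) , blocks⇒admissible b (suc k)
blocks⇒admissible {k} (double b) p =
  (lowerBound≤ k p , ≤-refl) , (≤-reflexive (lowerBound-diagonal k) , n≤1+n _) , blocks⇒admissible b (suc k)

mutual
  admissible⇒blocks : lowerBound k p ≡ suc k → Admissible k p xs → Blocks k xs
  admissible⇒blocks {xs = []} _ _ = []
  admissible⇒blocks {xs = x ∷ xs} forced (entry , rest) with admissibleEntry-forced forced entry
  ... | refl = admissible⇒blocks-cons rest

  admissible⇒blocks-cons : Admissible (suc k) (suc k) xs → Blocks k (suc k ∷ xs)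
  admissible⇒blocks-cons {xs = []} _ = single []
  admissible⇒blocks-cons {k} {y ∷ ys} ((lower , upper) , rest) with y ≟ suc k
  ... | yes refl = double (admissible⇒blocks (lowerBound-lagging (suc k)) rest)
  ... | no y≢ with ≤-antisym upper (≤∧≢⇒< (subst (_≤ y) (lowerBound-diagonal k) lower) (y≢ ∘ sym))
  ...   | refl = single (admissible⇒blocks-cons rest)

blocks⇔admissible : Blocks 0 xs ⇔ Admissible 0 0 xs
blocks⇔admissible = mk⇔ (λ blocks → blocks⇒admissible blocks 0) (admissible⇒blocks refl)

admissible⇒nth : Admissible k p xs →
                 ∀ j → j < length xs → AdmissibleEntry (k + j) (nth (p ∷ xs) (suc j)) (nth xs (suc j))
admissible⇒nth {xs = []}    _            j       ()
admissible⇒nth {k} {xs = _ ∷ _} (entry , _) zero    _ rewrite +-identityʳ k = entry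
admissible⇒nth {k} {xs = _ ∷ _} (_ , rest)  (suc j) (s≤s j<) rewrite +-suc k j = admissible⇒nth rest j j<

nth⇒admissible : ∀ k p xs →
                 (∀ j → j < length xs → AdmissibleEntry (k + j) (nth (p ∷ xs) (suc j)) (nth xs (suc j))) →
                 Admissible k p xs
nth⇒admissible k p []       _       = tt
nth⇒admissible k p (x ∷ xs) entries =
  subst (λ m → AdmissibleEntry m p x) (+-identityʳ k) (entries 0 (s≤s z≤n)) ,
  nth⇒admissible (suc k) x xs
    (λ j j< → subst (λ m → AdmissibleEntry m (nth (x ∷ xs) (suc j)) (nth xs (suc j)))
                    (+-suc k j) (entries (suc j) (s≤s j<)))

admissible⇔cc : ∀ b → length b ≡ n →
                Admissible 0 0 b ⇔ (∀ i → 1 ≤ i → i ≤ n → cc b i ≤ nth b i × nth b i ≤ i)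
admissible⇔cc b refl = mk⇔ to (λ bounds → nth⇒admissible 0 0 b (from bounds))
  where
  to : Admissible 0 0 b → ∀ i → 1 ≤ i → i ≤ length b → cc b i ≤ nth b i × nth b i ≤ i
  to adm (suc zero)    _ i≤ = admissible⇒nth adm 0 i≤
  to adm (suc (suc j)) _ i≤ = admissible⇒nth adm (suc j) i≤
  from : (∀ i → 1 ≤ i → i ≤ length b → cc b i ≤ nth b i × nth b i ≤ i) →
         ∀ j → j < length b → AdmissibleEntry j (nth (0 ∷ b) (suc j)) (nth b (suc j))
  from bounds zero    j< = bounds 1 (s≤s z≤n) j<
  from bounds (suc j) j< = bounds (suc (suc j)) (s≤s z≤n) j<

firstFree-free : ∀ {a} k → a ∉ occ → firstFree occ a (suc k) ≡ just a
firstFree-free {occ} {a} k a∉ rewrite dec-false (a ∈? occ) a∉ = refl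

firstFree-taken : ∀ {a} k → a ∈ occ → firstFree occ a (suc k) ≡ firstFree occ (suc a) k
firstFree-taken {occ} {a} k a∈ rewrite dec-true (a ∈? occ) a∈ = refl

firstFree-∉ : ∀ {a} k → firstFree occ a k ≡ just s → s ∉ occ
firstFree-∉ zero ()
firstFree-∉ {occ} {a = a} (suc k) found with a ∈? occ
... | yes _  = firstFree-∉ k found
... | no a∉ = subst (_∉ occ) (just-injective found) a∉

parkCar-unfold : ∀ {a} → a ≤ n → parkCar n occ a ≡ firstFree occ a (suc (n ∸ a))
parkCar-unfold {occ = occ} {a} a≤n = cong (firstFree occ a) (+-∸-assoc 1 a≤n)

parkCar-free : ∀ {a} → a ≤ n → a ∉ occ → parkCar n occ a ≡ just a
parkCar-free {n} {a = a} a≤n a∉ = trans (parkCar-unfold a≤n) (firstFree-free (n ∸ a) a∉)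

parkCar-next : ∀ {a} → suc a ≤ n → a ∈ occ → suc a ∉ occ → parkCar n occ a ≡ just (suc a)
parkCar-next {n} {occ} {a} sa≤n a∈ sa∉ = begin
  parkCar n occ a                            ≡⟨ parkCar-unfold (≤-trans (n≤1+n a) sa≤n) ⟩
  firstFree occ a (suc (n ∸ a))              ≡⟨ firstFree-taken (n ∸ a) a∈ ⟩
  firstFree occ (suc a) (n ∸ a)              ≡⟨ parkCar-unfold sa≤n ⟩
  firstFree occ (suc a) (suc (n ∸ suc a))    ≡⟨ firstFree-free (n ∸ suc a) sa∉ ⟩
  just (suc a)                               ∎
  where open ≡-Reasoning

parkCar-∉ : ∀ {a} → parkCar n occ a ≡ just s → s ∉ occ
parkCar-∉ {n} {a = a} = firstFree-∉ (suc n ∸ a)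

parkingRun-just : ∀ {a} → parkCar n occ a ≡ just s →
                  parkingRun n occ (a ∷ q) ≡ just s ∷ parkingRun n (s ∷ occ) q
parkingRun-just parked rewrite parked = refl

opaque
  occupied : ℕ → List ℕ → ℕ
  occupied s occ = if does (s ∈? occ) then 1 else 0

  occupied-∈ : s ∈ occ → occupied s occ ≡ 1
  occupied-∈ {s} {occ} s∈ rewrite dec-true (s ∈? occ) s∈ = refl

  occupied-∉ : s ∉ occ → occupied s occ ≡ 0
  occupied-∉ {s} {occ} s∉ rewrite dec-false (s ∈? occ) s∉ = refl

  occupied≤1 : ∀ s occ → occupied s occ ≤ 1
  occupied≤1 s occ with does (s ∈? occ)
  ... | true  = ≤-refl
  ... | false = z≤n

  occupied-cons : ∀ v → occupied v occ ≤ occupied v (s ∷ occ)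
  occupied-cons {occ} {s} v = case v ∈? occ of λ where
    (yes v∈) → subst (occupied v occ ≤_) (sym (occupied-∈ (there v∈))) (occupied≤1 v occ)
    (no v∉)  → subst (_≤ occupied v (s ∷ occ)) (sym (occupied-∉ v∉)) z≤n

occupiedPair : ℕ → List ℕ → ℕ
occupiedPair v occ = occupied v occ + occupied (suc v) occ

occupiedPair-cons : ∀ v → occupiedPair v occ ≤ occupiedPair v (s ∷ occ)
occupiedPair-cons v = +-mono-≤ (occupied-cons v) (occupied-cons (suc v))

occupiedPair-new : s ∉ occ → ParksAtOrNext (v , just s) → suc (occupiedPair v occ) ≤ occupiedPair v (s ∷ occ)
occupiedPair-new {s} {occ} s∉ (inj₁ refl)
  rewrite occupied-∉ s∉ | occupied-∈ {occ = s ∷ occ} (here refl) = s≤s (occupied-cons (suc s))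
occupiedPair-new {s} {occ} {v} s∉ (inj₂ refl)
  rewrite occupied-∉ s∉ | occupied-∈ {occ = s ∷ occ} (here refl)
        | +-comm (occupied v (s ∷ occ)) 1 | +-identityʳ (occupied v occ)
  = s≤s (occupied-cons v)

occupancy-step : ∀ {a} → s ∉ occ → ParksAtOrNext (a , just s) → ∀ v →
                 multiplicity v (a ∷ q) + occupiedPair v occ ≤ multiplicity v q + occupiedPair v (s ∷ occ)
occupancy-step {s} {occ} {q} {a} s∉ parks v with a ≟ v
... | yes refl = begin
  multiplicity a (a ∷ q) + occupiedPair a occ      ≡⟨ cong (_+ occupiedPair a occ) multiplicity-self ⟩
  suc (multiplicity a q + occupiedPair a occ)      ≡⟨ sym (+-suc _ _) ⟩
  multiplicity a q + suc (occupiedPair a occ)      ≤⟨ +-monoʳ-≤ (multiplicity a q) (occupiedPair-new s∉ parks) ⟩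
  multiplicity a q + occupiedPair a (s ∷ occ)      ∎
  where open ≤-Reasoning
... | no a≢v = begin
  multiplicity v (a ∷ q) + occupiedPair v occ      ≡⟨ cong (_+ occupiedPair v occ) (multiplicity-other a≢v) ⟩
  multiplicity v q + occupiedPair v occ            ≤⟨ +-monoʳ-≤ (multiplicity v q) (occupiedPair-cons v) ⟩
  multiplicity v q + occupiedPair v (s ∷ occ)      ∎
  where open ≤-Reasoning

parksAtOrNext⇒occupancy≤2 : ∀ n occ q → All ParksAtOrNext (zip q (parkingRun n occ q)) →
                            ∀ v → multiplicity v q + occupiedPair v occ ≤ 2
parksAtOrNext⇒occupancy≤2 n occ [] _ v =
  subst (λ m → m + occupiedPair v occ ≤ 2) (sym multiplicity-[])
        (+-mono-≤ (occupied≤1 v occ) (occupied≤1 (suc v) occ))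
parksAtOrNext⇒occupancy≤2 n occ (a ∷ q) parks v with parkCar n occ a in parked
parksAtOrNext⇒occupancy≤2 n occ (a ∷ q) (inj₁ () ∷ _) v | nothing
parksAtOrNext⇒occupancy≤2 n occ (a ∷ q) (inj₂ () ∷ _) v | nothing
parksAtOrNext⇒occupancy≤2 n occ (a ∷ q) (parks ∷ rest) v | just s =
  ≤-trans (occupancy-step (parkCar-∉ {n} {a = a} parked) parks v)
          (parksAtOrNext⇒occupancy≤2 n (s ∷ occ) q rest v)

unitInterval⇒atMostTwice : ∀ {n} (α : Vec ℕ n) → IsUnitIntervalPF α → AtMostTwice (toList α)
unitInterval⇒atMostTwice {n} α (_ , parks) v =
  ≤-trans (m≤m+n _ _) (parksAtOrNext⇒occupancy≤2 n [] (toList α) parks v)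

-- The spots filled by cars with preferences rp when each parks at its preference or right after it.
Claimed : List ℕ → ℕ → Set
Claimed rp s = s ∈ rp ⊎ ∃ λ u → s ≡ suc u × 2 ≤ multiplicity u rp

claimed-cons : Claimed rp s → Claimed (v ∷ rp) s
claimed-cons (inj₁ s∈rp) = inj₁ (there s∈rp)
claimed-cons {rp} {v = v} (inj₂ (u , s≡ , two)) = inj₂ (u , s≡ , ≤-trans two (multiplicity-cons {xs = rp} {v}))

-- rp lists the preferences of the cars parked so far, latest first, and occ their spots.
record Occupancy (rp occ : List ℕ) : Set where
  field
    preferences-taken : ∀ {u} → u ∈ rp → u ∈ occ
    taken-claimed     : ∀ {s} → s ∈ occ → Claimed rp s
open Occupancy

module _ {n} {W : List ℕ} (ranks : FubiniOffset 0 W) (twice : AtMostTwice W) (length≡n : length W ≡ n) where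

  rank-∈ : v ∈ W → v ≡ suc (countBelow v W)
  rank-∈ = All.lookup ranks

  entry-room : v ∈ W → k ≤ multiplicity v W → k + v ≤ suc n
  entry-room {v} {k} v∈W k≤ = begin
    k + v                                       ≡⟨ cong (k +_) (rank-∈ v∈W) ⟩
    k + suc (countBelow v W)                    ≡⟨ +-suc k _ ⟩
    suc (k + countBelow v W)                    ≤⟨ s≤s (+-monoˡ-≤ _ k≤) ⟩
    suc (multiplicity v W + countBelow v W)     ≡⟨ cong suc (trans (+-comm (multiplicity v W) _) (sym (countBelow-suc W))) ⟩
    suc (countBelow (suc v) W)                  ≤⟨ s≤s (subst (countBelow (suc v) W ≤_) length≡n (countBelow≤length W)) ⟩
    suc n                                       ∎
    where open ≤-Reasoning

  successor-absent : v ∈ W → 2 ≤ multiplicity v W → suc v ∉ W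
  successor-absent {v} v∈W two sv∈W = 1+n≰n (begin
    suc (suc (countBelow v W))                  ≡⟨ +-comm 2 _ ⟩
    countBelow v W + 2                          ≤⟨ +-monoʳ-≤ (countBelow v W) two ⟩
    countBelow v W + multiplicity v W           ≡⟨ sym (countBelow-suc W) ⟩
    countBelow (suc v) W                        ≡⟨ suc-injective (sym (rank-∈ sv∈W)) ⟩
    v                                           ≡⟨ rank-∈ v∈W ⟩
    suc (countBelow v W)                        ∎)
    where open ≤-Reasoning

  multiplicity-split : rp ++ q ↭ W → multiplicity x W ≡ multiplicity x rp + multiplicity x q
  multiplicity-split {rp} {q} perm = trans (sym (multiplicity-↭ perm)) (multiplicity-++ rp q)

  prefix-∈ : rp ++ q ↭ W → v ∈ rp → v ∈ W
  prefix-∈ perm v∈rp = ∈-resp-↭ perm (∈-++⁺ˡ v∈rp)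

  prefix-multiplicity : rp ++ q ↭ W → multiplicity x rp ≤ multiplicity x W
  prefix-multiplicity perm = subst (_ ≤_) (sym (multiplicity-split perm)) (m≤m+n _ _)

  arriving-∈ : rp ++ v ∷ q ↭ W → v ∈ W
  arriving-∈ {rp} perm = ∈-resp-↭ perm (∈-++⁺ʳ rp (here refl))

  arriving-counted : rp ++ v ∷ q ↭ W → suc (multiplicity v rp) ≤ multiplicity v W
  arriving-counted {rp} {v} {q} perm = begin
    suc (multiplicity v rp)                          ≤⟨ s≤s (m≤m+n _ _) ⟩
    suc (multiplicity v rp + multiplicity v q)       ≡⟨ sym (+-suc _ _) ⟩
    multiplicity v rp + suc (multiplicity v q)       ≡⟨ cong (multiplicity v rp +_) (sym (multiplicity-self)) ⟩
    multiplicity v rp + multiplicity v (v ∷ q)       ≡⟨ sym (multiplicity-split perm) ⟩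
    multiplicity v W                                 ∎
    where open ≤-Reasoning

  park-fresh : Occupancy rp occ → rp ++ v ∷ q ↭ W → v ∉ rp →
               parkCar n occ v ≡ just v × Occupancy (v ∷ rp) (v ∷ occ)
  park-fresh {rp} {occ} {v} occupancy perm v∉rp = parkCar-free v≤n v∉occ , record
    { preferences-taken = λ { (here refl) → here refl ; (there u∈) → there (preferences-taken occupancy u∈) }
    ; taken-claimed     = λ { (here refl) → inj₁ (here refl)
                            ; (there s∈) → claimed-cons (taken-claimed occupancy s∈) }
    }
    where
    v∈W : v ∈ W
    v∈W = arriving-∈ perm
    v≤n : v ≤ n
    v≤n = ≤-pred (entry-room v∈W (∈⇒multiplicity v∈W))
    v∉occ : v ∉ occ
    v∉occ v∈occ with taken-claimed occupancy v∈occ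
    ... | inj₁ v∈rp             = v∉rp v∈rp
    ... | inj₂ (u , refl , two) =
      successor-absent (prefix-∈ perm (multiplicity⇒∈ rp (≤-trans (s≤s z≤n) two)))
                       (≤-trans two (prefix-multiplicity perm)) v∈W

  park-repeat : Occupancy rp occ → rp ++ v ∷ q ↭ W → v ∈ rp → multiplicity v rp ≤ 1 →
                parkCar n occ v ≡ just (suc v) × Occupancy (v ∷ rp) (suc v ∷ occ)
  park-repeat {rp} {occ} {v} occupancy perm v∈rp once = parkCar-next sv≤n v∈occ sv∉occ , record
    { preferences-taken = λ { (here refl) → there v∈occ ; (there u∈) → there (preferences-taken occupancy u∈) }
    ; taken-claimed     = λ { (here refl) → inj₂ (v , refl , twice-now)
                            ; (there s∈) → claimed-cons (taken-claimed occupancy s∈) }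
    }
    where
    v∈occ : v ∈ occ
    v∈occ = preferences-taken occupancy v∈rp
    two : 2 ≤ multiplicity v W
    two = ≤-trans (s≤s (∈⇒multiplicity v∈rp)) (arriving-counted perm)
    sv≤n : suc v ≤ n
    sv≤n = ≤-pred (entry-room (arriving-∈ perm) two)
    twice-now : 2 ≤ multiplicity v (v ∷ rp)
    twice-now = subst (2 ≤_) (sym (multiplicity-self)) (s≤s (∈⇒multiplicity v∈rp))
    sv∉occ : suc v ∉ occ
    sv∉occ sv∈occ with taken-claimed occupancy sv∈occ
    ... | inj₁ sv∈rp          = successor-absent (arriving-∈ perm) two (prefix-∈ perm sv∈rp)
    ... | inj₂ (_ , refl , two′) = 1+n≰n (≤-trans two′ once)

  park-step : Occupancy rp occ → rp ++ v ∷ q ↭ W →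
              ∃ λ s → parkCar n occ v ≡ just s × ParksAtOrNext (v , just s) × Occupancy (v ∷ rp) (s ∷ occ)
  park-step {rp} {v = v} occupancy perm with v ∈? rp
  ... | no v∉rp =
    let parked , occupancy′ = park-fresh occupancy perm v∉rp in v , parked , inj₁ refl , occupancy′
  ... | yes v∈rp with multiplicity v rp ≤? 1
  ...   | yes once =
    let parked , occupancy′ = park-repeat occupancy perm v∈rp once in suc v , parked , inj₂ refl , occupancy′
  ...   | no more = contradiction (≤-trans (≤-trans (s≤s (≰⇒> more)) (arriving-counted perm)) (twice v)) 1+n≰n

  parksAtOrNext : Occupancy rp occ → rp ++ q ↭ W → All ParksAtOrNext (zip q (parkingRun n occ q))
  parksAtOrNext {q = []} _ _ = []
  parksAtOrNext {rp} {q = v ∷ q} occupancy perm with park-step occupancy perm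
  ... | s , parked , parks , occupancy′ =
    subst (λ outcomes → All ParksAtOrNext (zip (v ∷ q) outcomes)) (sym (parkingRun-just {a = v} parked))
      (parks ∷ parksAtOrNext occupancy′ (↭-trans (↭-sym (shift v rp q)) perm))

parksAtOrNext⇒parked : ∀ n occ q → All ParksAtOrNext (zip q (parkingRun n occ q)) →
                       All (λ o → ∃ λ s → o ≡ just s) (parkingRun n occ q)
parksAtOrNext⇒parked n occ []      _     = []
parksAtOrNext⇒parked n occ (a ∷ q) parks with parkCar n occ a
parksAtOrNext⇒parked n occ (a ∷ q) (inj₁ () ∷ _)    | nothing
parksAtOrNext⇒parked n occ (a ∷ q) (inj₂ () ∷ _)    | nothing
parksAtOrNext⇒parked n occ (a ∷ q) (_ ∷ parks)      | just s =
  (s , refl) ∷ parksAtOrNext⇒parked n (s ∷ occ) q parks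

fubini⇒unitInterval : ∀ {n} (α : Vec ℕ n) →
                      FubiniOffset 0 (toList α) → AtMostTwice (toList α) → IsUnitIntervalPF α
fubini⇒unitInterval {n} α ranks twice = parksAtOrNext⇒parked n [] (toList α) parks , parks
  where
  parks : All ParksAtOrNext (zip (toList α) (outcome α))
  parks = parksAtOrNext ranks twice (length-toList α) (record { preferences-taken = λ (); taken-claimed = λ () }) ↭-refl

unitFubini⇔fubini×atMostTwice : ∀ {n} (α : Vec ℕ n) →
                                 IsUnitFubini α ⇔ (FubiniOffset 0 (toList α) × AtMostTwice (toList α))
unitFubini⇔fubini×atMostTwice α = mk⇔
  (λ (fubini , unit) → Equivalence.to (fubiniRanking⇔fubiniOffset α) fubini , unitInterval⇒atMostTwice α unit)
  (λ (ranks , twice) → Equivalence.from (fubiniRanking⇔fubiniOffset α) ranks , fubini⇒unitInterval α ranks twice)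

fubini×atMostTwice-↭ : xs ↭ ys → (FubiniOffset k xs × AtMostTwice xs) ⇔ (FubiniOffset k ys × AtMostTwice ys)
fubini×atMostTwice-↭ xs↭ys = mk⇔
  (λ (ranks , twice) → fubiniOffset-↭ xs↭ys ranks , atMostTwice-↭ xs↭ys twice)
  (λ (ranks , twice) → fubiniOffset-↭ (↭-sym xs↭ys) ranks , atMostTwice-↭ (↭-sym xs↭ys) twice)

-- The range hypothesis is not needed: the entries of a Fubini ranking automatically lie in [n].
corollary3p7 : (n : ℕ) (α : Vec ℕ n) →
    (∀ k → 1 ≤ lookup α k × lookup α k ≤ n) →
    (IsUnitFubini α ⇔
      (∀ i → 1 ≤ i → i ≤ n → cc (rearr α) i ≤ nth (rearr α) i × nth (rearr α) i ≤ i))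
corollary3p7 n α _ =
  ⇔-trans (unitFubini⇔fubini×atMostTwice α)
  (⇔-trans (fubini×atMostTwice-↭ (↭-sym (sort-↭ (toList α))))
  (⇔-trans (sorted-fubini×atMostTwice⇔blocks (sort-↗ (toList α)))
  (⇔-trans blocks⇔admissible
           (admissible⇔cc (rearr α) (trans (↭-length (sort-↭ (toList α))) (length-toList α))))))
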